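{- Let $m$ be a positive integer and let $\lambda\in\mathbb{F}_{2^{4m}}$ satisfy $\lambda^{2^m+1}=1$. Consider the triple of maps $\mathbb{F}_{2^{4m}}\to\mathbb{F}_{2^{4m}}$ $$(\Phi_1,\Phi_2,\Phi_3)=\left(x^{2^{2m}},\ \lambda x^{2^{m}},\ \lambda x^{2^{3m}}\right).$$ Then $\Phi_1,\Phi_2,\Phi_3$ are permutations of $\mathbb{F}_{2^{4m}}$, the triple satisfies property $(\mathcal{A}_{4m})$, and $E^{\cup}\neq\mathbb{F}_{2^{4m}}$.
   Context: For a positive integer $n$ and $q=2^n$, three permutations $\Phi_1,\Phi_2,\Phi_3$ of $\mathbb{F}_q$ are said to satisfy property $(\mathcal{A}_n)$ if (1) $\Psi=\Phi_1+\Phi_2+\Phi_3$ is a permutation of $\mathbb{F}_q$, and (2) $\Psi^{ -1}=\Phi_1^{ -1}+\Phi_2^{ -1}+\Phi_3^{ -1}$ (sums are pointwise sums of functions, inverses are compositional inverses). For $1\le i<j\le 3$, $E_{i,j}=\{x\in\mathbb{F}_q:\Phi_i(x)=\Phi_j(x)\}$ and $E^{\cup}=E_{1,2}\cup E_{1,3}\cup E_{2,3}$. -}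

module Defs where

open import Level using (0ℓ)
open import Data.Nat using (ℕ; zero; suc; _+_; _*_)
  renaming (_^_ to _^ℕ_)
open import Data.Fin using (Fin)
open import Data.Product using (_×_; _,_; proj₁; ∃)
open import Data.Sum using (_⊎_)
open import Relation.Binary.PropositionalEquality using (_≡_)
open import Relation.Nullary using (¬_)
open import Algebra.Structures using (IsCommutativeRing)
open import Function.Bundles using (_↔_)
open import Function.Definitions using (Bijective)

-- A finite field with exactly 2^n elements (equality is propositional).
-- Characteristic 2 is recorded explicitly (it follows from the cardinality).
record FiniteField2 (n : ℕ) : Set₁ where
  infixl 6 _+F_
  infixl 7 _*F_
  field
    Carrier : Set
    _+F_ _*F_ : Carrier → Carrier → Carrier
    -F_ : Carrier → Carrier
    0F 1F : Carrier
    isCommutativeRing : IsCommutativeRing _≡_ _+F_ _*F_ -F_ 0F 1F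
    0≢1 : ¬ (0F ≡ 1F)
    inverse : ∀ x → ¬ (x ≡ 0F) → ∃ λ y → x *F y ≡ 1F
    char2 : 1F +F 1F ≡ 0F
    card : Carrier ↔ Fin (2 ^ℕ n)

  _^F_ : Carrier → ℕ → Carrier
  x ^F zero = 1F
  x ^F suc k = x *F (x ^F k)

  IsPerm : (Carrier → Carrier) → Set
  IsPerm f = Bijective _≡_ _≡_ f

  inv : {f : Carrier → Carrier} → IsPerm f → Carrier → Carrier
  inv (_ , surj) y = proj₁ (surj y)

  record PropertyA (Φ₁ Φ₂ Φ₃ : Carrier → Carrier) : Set where
    field
      perm₁ : IsPerm Φ₁
      perm₂ : IsPerm Φ₂
      perm₃ : IsPerm Φ₃
      permΨ : IsPerm (λ x → Φ₁ x +F Φ₂ x +F Φ₃ x)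
      invΨ  : ∀ y → inv permΨ y ≡ inv perm₁ y +F inv perm₂ y +F inv perm₃ y

  InEUnion : (Φ₁ Φ₂ Φ₃ : Carrier → Carrier) → Carrier → Set
  InEUnion Φ₁ Φ₂ Φ₃ x = (Φ₁ x ≡ Φ₂ x) ⊎ (Φ₁ x ≡ Φ₃ x) ⊎ (Φ₂ x ≡ Φ₃ x)

-- With φ(x) = x^(2^m) and σ(x) = λφ(x), the condition λ^(2^m+1) = λ·φ(λ) = 1 gives σ² = φ²,
-- and Fermat's little theorem gives φ⁴ = id; so (Φ₁, Φ₂, Φ₃) = (σ², σ, σ³) for an additive σ
-- of order 4. Hence Φ₁ is an involution, Φ₂ and Φ₃ are mutually inverse, and in
-- characteristic 2 also Ψ = σ² + σ + σ³ is an involution, which is property (A).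
-- A coincidence σⁱx = σʲx with i ≠ j in {1, 2, 3} forces σ²x = x, so E^∪ lies in the
-- fixed field of φ², which is proper because x^(2^(2m)) - x has at most 2^(2m) roots.

module Submission where

open import Defs
open import Data.Nat using (ℕ; suc; _+_; _*_; _^_)
open import Data.Product using (_×_)
open import Relation.Binary.PropositionalEquality using (_≡_)
open import Relation.Nullary using (¬_)

open import Level using (0ℓ)
open import Algebra.Bundles using (CommutativeRing)
open import Data.Bool using (if_then_else_)
open import Data.Empty using (⊥-elim)
open import Data.Fin using (Fin; punchIn) renaming (zero to fzero; suc to fsuc)
import Data.Fin as Fin
open import Data.Fin.Permutation using (Permutation; permutation)
open import Data.Fin.Properties using (punchInᵢ≢i; suc-injective; 0≢1+n)
open import Data.Nat using (zero; _≤_; _<_; z≤n; s≤s)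
open import Data.Nat.Properties using (<⇒≱; ^-monoʳ-<; *-monoˡ-<; ^-distribˡ-+-*) renaming (*-comm to ℕ*-comm)
open import Data.Product using (_,_; proj₁; proj₂; ∃; ∃₂)
open import Data.Sum using (inj₁; inj₂)
open import Data.Vec using (Vec; []; _∷_; replicate)
open import Function using (_∘_; Injective)
open import Function.Bundles using (Inverse; Injection; _↔_)
open import Function.Construct.Symmetry using (↔-sym)
open import Function.Consequences.Propositional
  using (inverseᵇ⇒bijective; strictlyInverseˡ⇒inverseˡ; strictlyInverseʳ⇒inverseʳ)
open import Function.Properties.Inverse using (↔⇒↣)
open import Relation.Binary.PropositionalEquality
  using (refl; sym; trans; cong; cong₂; module ≡-Reasoning)
open import Relation.Nullary using (Dec; yes; no; does)
open import Relation.Nullary.Decidable using (via-injection; dec-true; dec-false)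

module OrderFour {A : Set} (σ : A → A) (σ⁴≗id : ∀ x → σ (σ (σ (σ x))) ≡ x) where

  σx≡x⇒σ²x≡x : ∀ {x} → σ x ≡ x → σ (σ x) ≡ x
  σx≡x⇒σ²x≡x σx≡x = trans (cong σ σx≡x) σx≡x

  σ²x≡σx⇒σ²x≡x : ∀ {x} → σ (σ x) ≡ σ x → σ (σ x) ≡ x
  σ²x≡σx⇒σ²x≡x {x} e =
    σx≡x⇒σ²x≡x (trans (sym (σ⁴≗id (σ x))) (trans (cong (σ ∘ σ ∘ σ) e) (σ⁴≗id x)))

  σ²x≡σ³x⇒σ²x≡x : ∀ {x} → σ (σ x) ≡ σ (σ (σ x)) → σ (σ x) ≡ x
  σ²x≡σ³x⇒σ²x≡x {x} e =
    σx≡x⇒σ²x≡x (sym (trans (sym (σ⁴≗id x)) (trans (cong (σ ∘ σ) e) (σ⁴≗id (σ x)))))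

  σx≡σ³x⇒σ²x≡x : ∀ {x} → σ x ≡ σ (σ (σ x)) → σ (σ x) ≡ x
  σx≡σ³x⇒σ²x≡x {x} e =
    sym (trans (sym (σ⁴≗id x)) (trans (cong (σ ∘ σ ∘ σ) e) (σ⁴≗id (σ (σ x)))))

module FiniteFieldFacts {n : ℕ} (𝔽 : FiniteField2 n) where
  open FiniteField2 𝔽

  ring : CommutativeRing 0ℓ 0ℓ
  ring = record { isCommutativeRing = isCommutativeRing }

  open CommutativeRing ring
    using ( +-assoc; +-identityˡ; +-identityʳ; *-assoc; *-comm
          ; *-identityˡ; *-identityʳ; distribˡ; distribʳ; zeroˡ; zeroʳ
          ; commutativeSemiring; *-commutativeMonoid )
  open import Algebra.Solver.Ring.NaturalCoefficients.Default commutativeSemiring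
  open import Algebra.Properties.CommutativeSemiring.Exp commutativeSemiring
    using (^-homo-*; ^-assocʳ; ^-distrib-*)
    renaming (_^_ to _^ᴿ_)
  open ≡-Reasoning

  x+x≡0 : ∀ x → x +F x ≡ 0F
  x+x≡0 x = begin
    x +F x              ≡⟨ cong₂ _+F_ (sym (*-identityˡ x)) (sym (*-identityˡ x)) ⟩
    1F *F x +F 1F *F x  ≡⟨ distribʳ x 1F 1F ⟨
    (1F +F 1F) *F x     ≡⟨ cong (_*F x) char2 ⟩
    0F *F x             ≡⟨ zeroˡ x ⟩
    0F                  ∎

  x+y+y≡x : ∀ x y → x +F y +F y ≡ x
  x+y+y≡x x y = begin
    x +F y +F y    ≡⟨ +-assoc x y y ⟩
    x +F (y +F y)  ≡⟨ cong (x +F_) (x+x≡0 y) ⟩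
    x +F 0F        ≡⟨ +-identityʳ x ⟩
    x              ∎

  x+y≡0⇒x≡y : ∀ {x y} → x +F y ≡ 0F → x ≡ y
  x+y≡0⇒x≡y {x} {y} x+y≡0 = begin
    x            ≡⟨ x+y+y≡x x y ⟨
    x +F y +F y  ≡⟨ cong (_+F y) x+y≡0 ⟩
    0F +F y      ≡⟨ +-identityˡ y ⟩
    y            ∎

  x*y≡0⇒y≡0 : ∀ {x y} → ¬ x ≡ 0F → x *F y ≡ 0F → y ≡ 0F
  x*y≡0⇒y≡0 {x} {y} x≢0 xy≡0 = begin
    y               ≡⟨ *-identityˡ y ⟨
    1F *F y         ≡⟨ cong (_*F y) (trans (*-comm x⁻¹ x) x*x⁻¹≡1) ⟨
    x⁻¹ *F x *F y   ≡⟨ *-assoc x⁻¹ x y ⟩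
    x⁻¹ *F (x *F y) ≡⟨ cong (x⁻¹ *F_) xy≡0 ⟩
    x⁻¹ *F 0F       ≡⟨ zeroʳ x⁻¹ ⟩
    0F              ∎
    where
    x⁻¹ = proj₁ (inverse x x≢0)
    x*x⁻¹≡1 = proj₂ (inverse x x≢0)

  y*x≡x⇒y≡1 : ∀ {x y} → ¬ x ≡ 0F → y *F x ≡ x → y ≡ 1F
  y*x≡x⇒y≡1 {x} {y} x≢0 yx≡x = x+y≡0⇒x≡y (x*y≡0⇒y≡0 x≢0 (begin
    x *F (y +F 1F)       ≡⟨ distribˡ x y 1F ⟩
    x *F y +F x *F 1F    ≡⟨ cong₂ _+F_ (trans (*-comm x y) yx≡x) (*-identityʳ x) ⟩
    x +F x               ≡⟨ x+x≡0 x ⟩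
    0F                   ∎))

  ^F≡^ : ∀ x k → x ^F k ≡ x ^ᴿ k
  ^F≡^ x zero    = refl
  ^F≡^ x (suc k) = cong (x *F_) (^F≡^ x k)

  ^F-homo-* : ∀ x k l → x ^F (k + l) ≡ x ^F k *F x ^F l
  ^F-homo-* x k l = begin
    x ^F (k + l)       ≡⟨ ^F≡^ x (k + l) ⟩
    x ^ᴿ (k + l)       ≡⟨ ^-homo-* x k l ⟩
    x ^ᴿ k *F x ^ᴿ l   ≡⟨ cong₂ _*F_ (^F≡^ x k) (^F≡^ x l) ⟨
    x ^F k *F x ^F l   ∎

  ^F-assocʳ : ∀ x k l → (x ^F k) ^F l ≡ x ^F (k * l)
  ^F-assocʳ x k l = begin
    (x ^F k) ^F l   ≡⟨ ^F≡^ (x ^F k) l ⟩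
    (x ^F k) ^ᴿ l   ≡⟨ cong (_^ᴿ l) (^F≡^ x k) ⟩
    (x ^ᴿ k) ^ᴿ l   ≡⟨ ^-assocʳ x k l ⟩
    x ^ᴿ (k * l)    ≡⟨ ^F≡^ x (k * l) ⟨
    x ^F (k * l)    ∎

  ^F-distrib-* : ∀ x y k → (x *F y) ^F k ≡ x ^F k *F y ^F k
  ^F-distrib-* x y k = begin
    (x *F y) ^F k      ≡⟨ ^F≡^ (x *F y) k ⟩
    (x *F y) ^ᴿ k      ≡⟨ ^-distrib-* x y k ⟩
    x ^ᴿ k *F y ^ᴿ k   ≡⟨ cong₂ _*F_ (^F≡^ x k) (^F≡^ y k) ⟨
    x ^F k *F y ^F k   ∎

  square-+ : ∀ x y → (x +F y) ^F 2 ≡ x ^F 2 +F y ^F 2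
  square-+ x y = begin
    (x +F y) *F ((x +F y) *F 1F)
      ≡⟨ solve 2 (λ x y → (x :+ y) :* ((x :+ y) :* con 1)
                        := (x :* (x :* con 1) :+ y :* (y :* con 1)) :+ x :* y :+ x :* y) refl x y ⟩
    x ^F 2 +F y ^F 2 +F x *F y +F x *F y
      ≡⟨ x+y+y≡x (x ^F 2 +F y ^F 2) (x *F y) ⟩
    x ^F 2 +F y ^F 2 ∎

  ^2^-+ : ∀ k x y → (x +F y) ^F (2 ^ k) ≡ x ^F (2 ^ k) +F y ^F (2 ^ k)
  ^2^-+ zero    x y = trans (*-identityʳ (x +F y)) (sym (cong₂ _+F_ (*-identityʳ x) (*-identityʳ y)))
  ^2^-+ (suc k) x y = begin
    (x +F y) ^F (2 * 2 ^ k)                  ≡⟨ ^F-assocʳ (x +F y) 2 (2 ^ k) ⟨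
    ((x +F y) ^F 2) ^F (2 ^ k)               ≡⟨ cong (_^F (2 ^ k)) (square-+ x y) ⟩
    (x ^F 2 +F y ^F 2) ^F (2 ^ k)            ≡⟨ ^2^-+ k (x ^F 2) (y ^F 2) ⟩
    (x ^F 2) ^F (2 ^ k) +F (y ^F 2) ^F (2 ^ k)
      ≡⟨ cong₂ _+F_ (^F-assocʳ x 2 (2 ^ k)) (^F-assocʳ y 2 (2 ^ k)) ⟩
    x ^F (2 * 2 ^ k) +F y ^F (2 * 2 ^ k)     ∎

  _≟_ : (x y : Carrier) → Dec (x ≡ y)
  _≟_ = via-injection (↔⇒↣ card) Fin._≟_

  ifZero_then_else_ : Carrier → Carrier → Carrier → Carrier
  ifZero y then u else v = if does (y ≟ 0F) then u else v

  ifZero-≡0 : ∀ {y} u v → y ≡ 0F → ifZero y then u else v ≡ u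
  ifZero-≡0 {y} u v y≡0 = cong (if_then u else v) (dec-true (y ≟ 0F) y≡0)

  ifZero-≢0 : ∀ {y} u v → ¬ y ≡ 0F → ifZero y then u else v ≡ v
  ifZero-≢0 {y} u v y≢0 = cong (if_then u else v) (dec-false (y ≟ 0F) y≢0)

  -- 0 is replaced by 1, so that a product of unitParts over the whole field is a unit.
  unitPart : Carrier → Carrier
  unitPart y = ifZero y then 1F else y

  unitPart-≢0 : ∀ y → ¬ unitPart y ≡ 0F
  unitPart-≢0 y with y ≟ 0F
  ... | yes y≡0 = λ e → 0≢1 (sym (trans (sym (ifZero-≡0 1F y y≡0)) e))
  ... | no y≢0  = λ e → y≢0 (trans (sym (ifZero-≢0 1F y y≢0)) e)

  unitPart-* : ∀ {a} → ¬ a ≡ 0F → ∀ y → unitPart (a *F y) ≡ (ifZero y then 1F else a) *F unitPart y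
  unitPart-* {a} a≢0 y with y ≟ 0F
  ... | yes y≡0 = begin
    unitPart (a *F y)                            ≡⟨ ifZero-≡0 1F _ (trans (cong (a *F_) y≡0) (zeroʳ a)) ⟩
    1F                                           ≡⟨ *-identityˡ 1F ⟨
    1F *F 1F                                     ≡⟨ cong₂ _*F_ (ifZero-≡0 1F a y≡0) (ifZero-≡0 1F y y≡0) ⟨
    (ifZero y then 1F else a) *F unitPart y      ∎
  ... | no y≢0  = begin
    unitPart (a *F y)                            ≡⟨ ifZero-≢0 1F _ (λ ay≡0 → y≢0 (x*y≡0⇒y≡0 a≢0 ay≡0)) ⟩
    a *F y                                       ≡⟨ cong₂ _*F_ (ifZero-≢0 1F a y≢0) (ifZero-≢0 1F y y≢0) ⟨
    (ifZero y then 1F else a) *F unitPart y      ∎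

  open import Algebra.Properties.CommutativeMonoid.Sum *-commutativeMonoid
    using (sum-permute; sum-cong-≗; ∑-distrib-+; sum-remove; sum-replicate)
    renaming (sum to product)

  product-≢0 : ∀ {k} (v : Fin k → Carrier) → (∀ i → ¬ v i ≡ 0F) → ¬ product v ≡ 0F
  product-≢0 {zero}  v v≢0 1≡0 = 0≢1 (sym 1≡0)
  product-≢0 {suc k} v v≢0 v₀*rest≡0 =
    product-≢0 (v ∘ fsuc) (v≢0 ∘ fsuc) (x*y≡0⇒y≡0 (v≢0 fzero) v₀*rest≡0)

  module Enumeration {M : ℕ} (enum : Carrier ↔ Fin (suc M)) where
    open Inverse enum using (to; from; strictlyInverseˡ; strictlyInverseʳ)

    ∏ : (Carrier → Carrier) → Carrier
    ∏ f = product (f ∘ from)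

    ∏-reindex : ∀ f g g⁻¹ → (∀ x → g (g⁻¹ x) ≡ x) → (∀ x → g⁻¹ (g x) ≡ x) → ∏ (f ∘ g) ≡ ∏ f
    ∏-reindex f g g⁻¹ gg⁻¹ g⁻¹g = sym (begin
      product (f ∘ from)                  ≡⟨ sum-permute (f ∘ from) π ⟩
      product (f ∘ from ∘ to ∘ g ∘ from)  ≡⟨ sum-cong-≗ (λ i → cong f (strictlyInverseʳ (g (from i)))) ⟩
      product (f ∘ g ∘ from)              ∎)
      where
      conjugate-inverse : ∀ h h⁻¹ → (∀ x → h (h⁻¹ x) ≡ x) → ∀ i → to (h (from (to (h⁻¹ (from i))))) ≡ i
      conjugate-inverse h h⁻¹ hh⁻¹ i =
        trans (cong (to ∘ h) (strictlyInverseʳ _)) (trans (cong to (hh⁻¹ (from i))) (strictlyInverseˡ i))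
      π : Permutation (suc M) (suc M)
      π = permutation (to ∘ g ∘ from) (to ∘ g⁻¹ ∘ from) (conjugate-inverse g g⁻¹ gg⁻¹) (conjugate-inverse g⁻¹ g g⁻¹g)

    ∏-* : ∀ f g → ∏ (λ x → f x *F g x) ≡ ∏ f *F ∏ g
    ∏-* f g = ∑-distrib-+ (f ∘ from) (g ∘ from)

    ∏-ifZero : ∀ a → ∏ (λ y → ifZero y then 1F else a) ≡ a ^F M
    ∏-ifZero a = begin
      product v                                   ≡⟨ sum-remove {i = to 0F} v ⟩
      v (to 0F) *F product (v ∘ punchIn (to 0F))
        ≡⟨ cong₂ _*F_ (ifZero-≡0 1F a (strictlyInverseʳ 0F)) (sum-cong-≗ v≡a-off-0) ⟩
      1F *F product {M} (λ _ → a)                 ≡⟨ *-identityˡ _ ⟩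
      product {M} (λ _ → a)                       ≡⟨ sum-replicate M {a} ⟩
      a ^ᴿ M                                      ≡⟨ ^F≡^ a M ⟨
      a ^F M                                      ∎
      where
      v = λ i → ifZero from i then 1F else a
      v≡a-off-0 : ∀ j → v (punchIn (to 0F) j) ≡ a
      v≡a-off-0 j = ifZero-≢0 1F a λ x≡0 →
        punchInᵢ≢i (to 0F) j (trans (sym (strictlyInverseˡ _)) (cong to x≡0))

    unit^M≡1 : ∀ {a} → ¬ a ≡ 0F → a ^F M ≡ 1F
    unit^M≡1 {a} a≢0 = y*x≡x⇒y≡1 (product-≢0 (unitPart ∘ from) (unitPart-≢0 ∘ from)) (sym (begin
      ∏ unitPart                                              ≡⟨ ∏-reindex unitPart (a *F_) (a⁻¹ *F_) a*a⁻¹* a⁻¹*a* ⟨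
      ∏ (λ y → unitPart (a *F y))                             ≡⟨ sum-cong-≗ (unitPart-* a≢0 ∘ from) ⟩
      ∏ (λ y → (ifZero y then 1F else a) *F unitPart y)       ≡⟨ ∏-* (λ y → ifZero y then 1F else a) unitPart ⟩
      ∏ (λ y → ifZero y then 1F else a) *F ∏ unitPart         ≡⟨ cong (_*F ∏ unitPart) (∏-ifZero a) ⟩
      a ^F M *F ∏ unitPart                                    ∎))
      where
      a⁻¹ = proj₁ (inverse a a≢0)
      a*a⁻¹≡1 = proj₂ (inverse a a≢0)
      a*a⁻¹* : ∀ y → a *F (a⁻¹ *F y) ≡ y
      a*a⁻¹* y = trans (sym (*-assoc a a⁻¹ y)) (trans (cong (_*F y) a*a⁻¹≡1) (*-identityˡ y))
      a⁻¹*a* : ∀ y → a⁻¹ *F (a *F y) ≡ y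
      a⁻¹*a* y = trans (sym (*-assoc a⁻¹ a y)) (trans (cong (_*F y) (trans (*-comm a⁻¹ a) a*a⁻¹≡1)) (*-identityˡ y))

  fermat : ∀ {M} → Carrier ↔ Fin M → ∀ x → x ^F M ≡ x
  fermat {zero}  enum x with () ← Inverse.to enum x
  fermat {suc M} enum x with x ≟ 0F
  ... | yes refl = zeroˡ _
  ... | no x≢0   = trans (cong (x *F_) (Enumeration.unit^M≡1 enum x≢0)) (*-identityʳ x)

  -- evalMonic (c₀ ∷ ⋯ ∷ c_{d-1}) x = c₀ + c₁ x + ⋯ + c_{d-1} x^{d-1} + x^d.
  evalMonic : ∀ {d} → Vec Carrier d → Carrier → Carrier
  evalMonic []       x = 1F
  evalMonic (c ∷ cs) x = c +F x *F evalMonic cs x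

  -- x + a is x - a in characteristic 2.
  divide-by-linear : ∀ {d} (p : Vec Carrier (suc d)) a →
    ∃₂ λ (q : Vec Carrier d) r → ∀ x → evalMonic p x ≡ (x +F a) *F evalMonic q x +F r
  divide-by-linear (c ∷ []) a = [] , c +F a , λ x → begin
    c +F x *F 1F                  ≡⟨ x+y+y≡x _ a ⟨
    c +F x *F 1F +F a +F a        ≡⟨ solve 3 (λ c x a → c :+ x :* con 1 :+ a :+ a
                                                    := (x :+ a) :* con 1 :+ (c :+ a)) refl c x a ⟩
    (x +F a) *F 1F +F (c +F a)    ∎
  divide-by-linear (c ∷ c′ ∷ cs) a with divide-by-linear (c′ ∷ cs) a
  ... | q , r , p′≡ = r ∷ q , c +F a *F r , λ x → begin
    c +F x *F evalMonic (c′ ∷ cs) x                        ≡⟨ cong (λ t → c +F x *F t) (p′≡ x) ⟩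
    c +F x *F ((x +F a) *F evalMonic q x +F r)             ≡⟨ x+y+y≡x _ (a *F r) ⟨
    c +F x *F ((x +F a) *F evalMonic q x +F r) +F a *F r +F a *F r
      ≡⟨ solve 5 (λ c x a Q r → c :+ x :* ((x :+ a) :* Q :+ r) :+ a :* r :+ a :* r
                              := (x :+ a) :* (r :+ x :* Q) :+ (c :+ a :* r)) refl c x a (evalMonic q x) r ⟩
    (x +F a) *F (r +F x *F evalMonic q x) +F (c +F a *F r)  ∎

  factor-theorem : ∀ {d} (p : Vec Carrier (suc d)) a → evalMonic p a ≡ 0F →
    ∃ λ (q : Vec Carrier d) → ∀ x → evalMonic p x ≡ (x +F a) *F evalMonic q x
  factor-theorem p a pa≡0 with divide-by-linear p a
  ... | q , r , p≡ = q , λ x → trans (p≡ x) (trans (cong ((x +F a) *F evalMonic q x +F_) r≡0) (+-identityʳ _))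
    where
    r≡0 : r ≡ 0F
    r≡0 = begin
      r                                  ≡⟨ +-identityˡ r ⟨
      0F +F r                            ≡⟨ cong (_+F r) (zeroˡ (evalMonic q a)) ⟨
      0F *F evalMonic q a +F r           ≡⟨ cong (λ t → t *F evalMonic q a +F r) (x+x≡0 a) ⟨
      (a +F a) *F evalMonic q a +F r     ≡⟨ p≡ a ⟨
      evalMonic p a                      ≡⟨ pa≡0 ⟩
      0F                                 ∎

  roots≤degree : ∀ {d k} (p : Vec Carrier d) (root : Fin k → Carrier) → Injective _≡_ _≡_ root →
    (∀ i → evalMonic p (root i) ≡ 0F) → k ≤ d
  roots≤degree {k = zero}  p        root inj isRoot = z≤n
  roots≤degree {k = suc k} []       root inj isRoot = ⊥-elim (0≢1 (sym (isRoot fzero)))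
  roots≤degree {k = suc k} (c ∷ cs) root inj isRoot with factor-theorem (c ∷ cs) (root fzero) (isRoot fzero)
  ... | q , p≡ = s≤s (roots≤degree q (root ∘ fsuc) (λ e → suc-injective (inj e)) isRootOfQuotient)
    where
    isRootOfQuotient : ∀ i → evalMonic q (root (fsuc i)) ≡ 0F
    isRootOfQuotient i = x*y≡0⇒y≡0 (λ e → 0≢1+n (sym (inj (x+y≡0⇒x≡y e))))
                                    (trans (sym (p≡ (root (fsuc i)))) (isRoot (fsuc i)))

  ¬∀x^k≡x : ∀ {M k} → Carrier ↔ Fin M → 1 < k → k < M → ¬ (∀ x → x ^F k ≡ x)
  ¬∀x^k≡x {k = suc (suc K)} enum (s≤s (s≤s z≤n)) k<M x^k≡x =
    <⇒≱ k<M (roots≤degree (0F ∷ 1F ∷ replicate K 0F) from from-injective isRoot)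
    where
    open Inverse enum using (from)
    from-injective : Injective _≡_ _≡_ from
    from-injective = Injection.injective (↔⇒↣ (↔-sym enum))
    zeros-evaluate : ∀ k x → evalMonic (replicate k 0F) x ≡ x ^F k
    zeros-evaluate zero    x = refl
    zeros-evaluate (suc k) x = trans (+-identityˡ _) (cong (x *F_) (zeros-evaluate k x))
    isRoot : ∀ i → evalMonic (0F ∷ 1F ∷ replicate K 0F) (from i) ≡ 0F
    isRoot i = begin
      0F +F x *F (1F +F x *F evalMonic (replicate K 0F) x)  ≡⟨ +-identityˡ _ ⟩
      x *F (1F +F x *F evalMonic (replicate K 0F) x)        ≡⟨ distribˡ x 1F _ ⟩
      x *F 1F +F x *F (x *F evalMonic (replicate K 0F) x)
        ≡⟨ cong₂ _+F_ (*-identityʳ x) (cong (λ t → x *F (x *F t)) (zeros-evaluate K x)) ⟩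
      x +F x ^F suc (suc K)                                 ≡⟨ cong (x +F_) (x^k≡x x) ⟩
      x +F x                                                ≡⟨ x+x≡0 x ⟩
      0F                                                    ∎
      where x = from i

  inverses⇒perm : ∀ {f g : Carrier → Carrier} → (∀ y → f (g y) ≡ y) → (∀ x → g (f x) ≡ x) → IsPerm f
  inverses⇒perm {f} fg gf =
    inverseᵇ⇒bijective (strictlyInverseˡ⇒inverseˡ f fg , strictlyInverseʳ⇒inverseʳ f gf)

  -- Φ₁ and Φ₃ are only pointwise equal to σ² and σ³, so that the results apply to the
  -- maps of the theorem as literally given (there is no function extensionality).
  module AdditiveOrderFour
    (σ : Carrier → Carrier) (σ-+ : ∀ x y → σ (x +F y) ≡ σ x +F σ y)
    (σ⁴≗id : ∀ x → σ (σ (σ (σ x))) ≡ x)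
    (Φ₁ Φ₃ : Carrier → Carrier)
    (Φ₁≗σ² : ∀ x → Φ₁ x ≡ σ (σ x)) (Φ₃≗σ³ : ∀ x → Φ₃ x ≡ σ (σ (σ x)))
    where
    open OrderFour σ σ⁴≗id

    Φ₁-involutive : ∀ x → Φ₁ (Φ₁ x) ≡ x
    Φ₁-involutive x = trans (Φ₁≗σ² (Φ₁ x)) (trans (cong (σ ∘ σ) (Φ₁≗σ² x)) (σ⁴≗id x))

    σ∘Φ₃≗id : ∀ x → σ (Φ₃ x) ≡ x
    σ∘Φ₃≗id x = trans (cong σ (Φ₃≗σ³ x)) (σ⁴≗id x)

    Φ₃∘σ≗id : ∀ x → Φ₃ (σ x) ≡ x
    Φ₃∘σ≗id x = trans (Φ₃≗σ³ (σ x)) (σ⁴≗id x)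

    σ-+₃ : ∀ x y z → σ (x +F y +F z) ≡ σ x +F σ y +F σ z
    σ-+₃ x y z = trans (σ-+ (x +F y) z) (cong (_+F σ z) (σ-+ x y))

    Ψ : Carrier → Carrier
    Ψ x = Φ₁ x +F σ x +F Φ₃ x

    Ψ≗σ²+σ+σ³ : ∀ x → Ψ x ≡ σ (σ x) +F σ x +F σ (σ (σ x))
    Ψ≗σ²+σ+σ³ x = cong₂ (λ u v → u +F σ x +F v) (Φ₁≗σ² x) (Φ₃≗σ³ x)

    σ∘Ψ : ∀ x → σ (Ψ x) ≡ σ (σ (σ x)) +F σ (σ x) +F x
    σ∘Ψ x = trans (cong σ (Ψ≗σ²+σ+σ³ x))
              (trans (σ-+₃ _ _ _) (cong (σ (σ (σ x)) +F σ (σ x) +F_) (σ⁴≗id x)))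

    σ²∘Ψ : ∀ x → σ (σ (Ψ x)) ≡ x +F σ (σ (σ x)) +F σ x
    σ²∘Ψ x = trans (cong σ (σ∘Ψ x))
               (trans (σ-+₃ _ _ _) (cong (λ u → u +F σ (σ (σ x)) +F σ x) (σ⁴≗id x)))

    σ³∘Ψ : ∀ x → σ (σ (σ (Ψ x))) ≡ σ x +F x +F σ (σ x)
    σ³∘Ψ x = trans (cong σ (σ²∘Ψ x))
               (trans (σ-+₃ _ _ _) (cong (λ u → σ x +F u +F σ (σ x)) (σ⁴≗id x)))

    -- This is (t² + t + t³)² = t⁴ + t² + t⁶ = 1 in 𝔽₂[t]/(t⁴ + 1), with t acting as σ.
    Ψ-involutive : ∀ x → Ψ (Ψ x) ≡ x
    Ψ-involutive x = begin
      Ψ (Ψ x)                                              ≡⟨ Ψ≗σ²+σ+σ³ (Ψ x) ⟩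
      σ (σ (Ψ x)) +F σ (Ψ x) +F σ (σ (σ (Ψ x)))
        ≡⟨ cong₂ _+F_ (cong₂ _+F_ (σ²∘Ψ x) (σ∘Ψ x)) (σ³∘Ψ x) ⟩
      (x +F c +F b) +F (c +F a +F x) +F (b +F x +F a)
        ≡⟨ solve 4 (λ x a b c → (x :+ c :+ b) :+ (c :+ a :+ x) :+ (b :+ x :+ a)
                              := x :+ (a :+ b :+ c :+ x) :+ (a :+ b :+ c :+ x)) refl x a b c ⟩
      x +F (a +F b +F c +F x) +F (a +F b +F c +F x)        ≡⟨ x+y+y≡x x _ ⟩
      x                                                    ∎
      where
      a = σ (σ x)
      b = σ x
      c = σ (σ (σ x))

    propertyA : PropertyA Φ₁ σ Φ₃
    propertyA = record
      { perm₁ = inverses⇒perm Φ₁-involutive Φ₁-involutive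
      ; perm₂ = inverses⇒perm σ∘Φ₃≗id Φ₃∘σ≗id
      ; perm₃ = inverses⇒perm Φ₃∘σ≗id σ∘Φ₃≗id
      ; permΨ = inverses⇒perm Ψ-involutive Ψ-involutive
      ; invΨ  = λ y → solve 3 (λ a b c → a :+ b :+ c := a :+ c :+ b) refl (Φ₁ y) (σ y) (Φ₃ y)
      }

    inEUnion⇒σ²-fixed : ∀ {x} → InEUnion Φ₁ σ Φ₃ x → σ (σ x) ≡ x
    inEUnion⇒σ²-fixed {x} (inj₁ e)        = σ²x≡σx⇒σ²x≡x (trans (sym (Φ₁≗σ² x)) e)
    inEUnion⇒σ²-fixed {x} (inj₂ (inj₁ e)) = σ²x≡σ³x⇒σ²x≡x (trans (sym (Φ₁≗σ² x)) (trans e (Φ₃≗σ³ x)))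
    inEUnion⇒σ²-fixed {x} (inj₂ (inj₂ e)) = σx≡σ³x⇒σ²x≡x (trans e (Φ₃≗σ³ x))

module Frobenius {m : ℕ} (𝔽 : FiniteField2 (4 * suc m)) where
  open FiniteField2 𝔽
  open FiniteFieldFacts 𝔽
  open CommutativeRing ring using (*-assoc; *-comm; *-identityˡ; *-identityʳ; distribˡ)
  open ≡-Reasoning

  s q : ℕ
  s = suc m
  q = 2 ^ s

  φ : Carrier → Carrier
  φ x = x ^F q

  φ-+ : ∀ x y → φ (x +F y) ≡ φ x +F φ y
  φ-+ = ^2^-+ s

  φ-* : ∀ x y → φ (x *F y) ≡ φ x *F φ y
  φ-* x y = ^F-distrib-* x y q

  ^2^[k*s]-step : ∀ k x → x ^F (2 ^ (suc k * s)) ≡ φ (x ^F (2 ^ (k * s)))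
  ^2^[k*s]-step k x = begin
    x ^F (2 ^ (s + k * s))      ≡⟨ cong (x ^F_) (trans (^-distribˡ-+-* 2 s (k * s)) (ℕ*-comm q _)) ⟩
    x ^F (2 ^ (k * s) * q)      ≡⟨ ^F-assocʳ x (2 ^ (k * s)) q ⟨
    φ (x ^F (2 ^ (k * s)))      ∎

  ^2^[2s]≗φ² : ∀ x → x ^F (2 ^ (2 * s)) ≡ φ (φ x)
  ^2^[2s]≗φ² x = trans (^2^[k*s]-step 1 x) (cong φ (trans (^2^[k*s]-step 0 x) (cong φ (*-identityʳ x))))

  ^2^[3s]≗φ³ : ∀ x → x ^F (2 ^ (3 * s)) ≡ φ (φ (φ x))
  ^2^[3s]≗φ³ x = trans (^2^[k*s]-step 2 x) (cong φ (^2^[2s]≗φ² x))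

  φ⁴≗id : ∀ x → φ (φ (φ (φ x))) ≡ x
  φ⁴≗id x = trans (cong φ (sym (^2^[3s]≗φ³ x))) (trans (sym (^2^[k*s]-step 3 x)) (fermat card x))

  φ²≢id : ¬ (∀ x → φ (φ x) ≡ x)
  φ²≢id φ²≗id = ¬∀x^k≡x card 1<2^[2s] 2^[2s]<2^[4s] (λ x → trans (^2^[2s]≗φ² x) (φ²≗id x))
    where
    1<2^[2s] : 1 < 2 ^ (2 * s)
    1<2^[2s] = ^-monoʳ-< 2 (s≤s (s≤s z≤n)) {0} {2 * s} (s≤s z≤n)
    2^[2s]<2^[4s] : 2 ^ (2 * s) < 2 ^ (4 * s)
    2^[2s]<2^[4s] = ^-monoʳ-< 2 (s≤s (s≤s z≤n)) {2 * s} {4 * s} (*-monoˡ-< s {2} {4} (s≤s (s≤s (s≤s z≤n))))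

  module Twisted (λ' : Carrier) (λ'^[q+1]≡1 : λ' ^F (q + 1) ≡ 1F) where

    σ : Carrier → Carrier
    σ x = λ' *F φ x

    λ'*φλ'≡1 : λ' *F φ λ' ≡ 1F
    λ'*φλ'≡1 = begin
      λ' *F φ λ'          ≡⟨ *-comm λ' (φ λ') ⟩
      φ λ' *F λ'          ≡⟨ cong (φ λ' *F_) (*-identityʳ λ') ⟨
      φ λ' *F λ' ^F 1     ≡⟨ ^F-homo-* λ' q 1 ⟨
      λ' ^F (q + 1)       ≡⟨ λ'^[q+1]≡1 ⟩
      1F                  ∎

    σ-+ : ∀ x y → σ (x +F y) ≡ σ x +F σ y
    σ-+ x y = trans (cong (λ' *F_) (φ-+ x y)) (distribˡ λ' (φ x) (φ y))

    σ²≗φ² : ∀ x → σ (σ x) ≡ φ (φ x)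
    σ²≗φ² x = begin
      λ' *F φ (λ' *F φ x)          ≡⟨ cong (λ' *F_) (φ-* λ' (φ x)) ⟩
      λ' *F (φ λ' *F φ (φ x))      ≡⟨ *-assoc λ' (φ λ') (φ (φ x)) ⟨
      λ' *F φ λ' *F φ (φ x)        ≡⟨ cong (_*F φ (φ x)) λ'*φλ'≡1 ⟩
      1F *F φ (φ x)                ≡⟨ *-identityˡ (φ (φ x)) ⟩
      φ (φ x)                      ∎

    σ⁴≗id : ∀ x → σ (σ (σ (σ x))) ≡ x
    σ⁴≗id x = trans (σ²≗φ² (σ (σ x))) (trans (cong (φ ∘ φ) (σ²≗φ² x)) (φ⁴≗id x))

    Φ₁ Φ₃ : Carrier → Carrier
    Φ₁ x = x ^F (2 ^ (2 * s))
    Φ₃ x = λ' *F (x ^F (2 ^ (3 * s)))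

    Φ₁≗σ² : ∀ x → Φ₁ x ≡ σ (σ x)
    Φ₁≗σ² x = trans (^2^[2s]≗φ² x) (sym (σ²≗φ² x))

    Φ₃≗σ³ : ∀ x → Φ₃ x ≡ σ (σ (σ x))
    Φ₃≗σ³ x = trans (cong (λ' *F_) (^2^[3s]≗φ³ x)) (cong σ (sym (σ²≗φ² x)))

    open AdditiveOrderFour σ σ-+ σ⁴≗id Φ₁ Φ₃ Φ₁≗σ² Φ₃≗σ³ public

mainTheorem1 : (m : ℕ) → (F : FiniteField2 (4 * suc m)) →
    let open FiniteField2 F in
    (λ' : Carrier) → λ' ^F (2 ^ suc m + 1) ≡ 1F →
    let Φ₁ = λ x → x ^F (2 ^ (2 * suc m))
        Φ₂ = λ x → λ' *F (x ^F (2 ^ suc m))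
        Φ₃ = λ x → λ' *F (x ^F (2 ^ (3 * suc m)))
    in IsPerm Φ₁ × IsPerm Φ₂ × IsPerm Φ₃ × PropertyA Φ₁ Φ₂ Φ₃
       × ¬ (∀ x → InEUnion Φ₁ Φ₂ Φ₃ x)
mainTheorem1 m 𝔽 λ' λ'^[q+1]≡1 = perm₁ , perm₂ , perm₃ , propertyA , E∪≢𝔽
  where
  open FiniteField2 𝔽
  open Frobenius 𝔽
  open Twisted λ' λ'^[q+1]≡1
  open PropertyA propertyA using (perm₁; perm₂; perm₃)
  E∪≢𝔽 : ¬ (∀ x → InEUnion Φ₁ σ Φ₃ x)
  E∪≢𝔽 E∪≡𝔽 = φ²≢id (λ x → trans (sym (σ²≗φ² x)) (inEUnion⇒σ²-fixed (E∪≡𝔽 x)))
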